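{- Let $k,m,c\ge 0$ be integers and let $(G,s_1,t_1,\ldots,s_k,t_k)$ be a problem instance with $(k,m,c)$-tracker $H$. Then every path in $H$ from $s_0$ to $t_0$ traces some linkage for $(G,s_1,t_1,\ldots,s_k,t_k)$.
   Context: All digraphs are finite, without loops or parallel edges. Paths are directed and have at least one vertex; $s(P),t(P)$ denote the first and last vertices of $P$; $P\setminus v$ denotes $P$ with vertex $v$ deleted. A problem instance is $(G,s_1,t_1,\ldots,s_k,t_k)$ with $G$ a digraph and $s_i,t_i\in V(G)$. A linkage in $G$ is a sequence of pairwise vertex-disjoint paths; $V(L)$ is the union of their vertex sets; a linkage for the instance is $(P_1,\ldots,P_k)$ with $P_i$ from $s_i$ to $t_i$. For a subdigraph $F$ of $G$, a vertex $v\in V(G)\setminus V(F)$ is $F$-outward if there is no edge from $v$ to a vertex of $F$, and $F$-inward if there is no edge from a vertex of $F$ to $v$. For a linkage $L=(M_1,\ldots,M_k)$ in $G$, $A(L)$ is the set of vertices in $V(G)\setminus V(L)$ that are $(M_j\setminus t(M_j))$-inward for some $j$ with $t(M_j)\ne t_j$, and $B(L)$ the set of vertices in $V(G)\setminus V(L)$ that are $(M_j\setminus s(M_j))$-outward for some $j$ with $s(M_j)\ne s_j$; the confusion of $L$ is $|A(L)\cap B(L)|$. A $(k,m,c)$-rail is a triple $(L,X,Y)$ where $L=(M_1,\ldots,M_k)$ is a linkage in $G$ of $k$ paths, each $M_j$ has at most $2m$ vertices and if fewer than $2m$ then $M_j$ has first vertex $s_j$ or last vertex $t_j$, $L$ has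 confusion at most $c$, $X,Y$ are disjoint subsets of $V(G)\setminus V(L)$, $X\subseteq A(L)$, $Y\subseteq B(L)$, and $X\cup Y=A(L)\cup B(L)$. For distinct rails $(L,X,Y),(L',X',Y')$ with $L=(P_1,\ldots,P_k)$, $L'=(P_1',\ldots,P_k')$, write $(L,X,Y)\rightarrow(L',X',Y')$ if for each $i$, $P_i\cup P_i'$ is a path from the first vertex of $P_i$ to the last vertex of $P_i'$, $V(P_i')\subseteq V(P_i)\cup X$ and $V(P_i)\subseteq V(P_i')\cup Y'$; and $X'\subseteq X$, $Y\subseteq Y'$. The $(k,m,c)$-tracker $H$ has vertex set the set $\mathcal T$ of all $(k,m,c)$-rails together with two new vertices $s_0,t_0$; for distinct $u,v\in\mathcal T$, $uv\in E(H)$ iff $u\rightarrow v$; $s_0v\in E(H)$ for $v=((M_1,\ldots,M_k),X,Y)\in\mathcal T$ iff each $M_j$ has first vertex $s_j$; $ut_0\in E(H)$ for $u=((M_1,\ldots,M_k),X,Y)\in\mathcal T$ iff each $M_j$ has last vertex $t_j$; there are no other edges. A path of $H$ with vertices $s_0,(L_1,X_1,Y_1),\ldots,(L_n,X_n,Y_n),t_0$ in order, where $L_p=(M_{p,1},\ldots,M_{p,k})$, traces a linkage $(P_1,\ldots,P_k)$ for the instance if $P_j$ is the union of $M_{1,j},\ldots,M_{n,j}$ for every $j$. -}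

module Defs where

open import Data.Nat using (ℕ; _≤_; _<_; _*_)
open import Data.Bool using (Bool; true; false)
open import Data.Fin using (Fin)
open import Data.Fin.Subset using (Subset; _⊆_) renaming (_∈_ to _∈ₛ_; _∉_ to _∉ₛ_)
open import Data.Vec using (Vec; lookup)
open import Data.List using (List; []; _∷_; _++_; [_]; map; head; last; length)
open import Data.List.Membership.Propositional using (_∈_; _∉_)
open import Data.List.Relation.Unary.Any using (Any)
open import Data.List.Relation.Unary.All using (All)
open import Data.List.Relation.Unary.Linked using (Linked)
open import Data.List.Relation.Unary.Unique.Propositional using (Unique)
open import Data.Maybe using (Maybe; just)
open import Data.Product using (Σ; ∃; _×_; _,_)
open import Data.Sum using (_⊎_)
open import Data.Empty using (⊥)
open import Data.Unit using (⊤)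
open import Relation.Nullary using (¬_)
open import Relation.Binary.PropositionalEquality using (_≡_; _≢_)

-- A finite digraph G on vertex set Fin n is given by its
-- adjacency function E (an edge u → v iff E u v ≡ true).  Looplessness
-- is a hypothesis of the main theorem; parallel edges cannot occur.

Loopless : {n : ℕ} → (Fin n → Fin n → Bool) → Set
Loopless {n} E = (v : Fin n) → E v v ≡ false

infix 3 _⇔_
_⇔_ : Set → Set → Set
A ⇔ B = (A → B) × (B → A)

-- Consecutive pairs of a vertex list: the edge set of the path it spells.
Consec : {n : ℕ} → List (Fin n) → Fin n → Fin n → Set
Consec []            u w = ⊥
Consec (x ∷ [])      u w = ⊥
Consec (x ∷ y ∷ r)   u w = (u ≡ x × w ≡ y) ⊎ Consec (y ∷ r) u w

module _ {n : ℕ} (E : Fin n → Fin n → Bool) where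

  Edge : Fin n → Fin n → Set
  Edge u v = E u v ≡ true

  -- A (directed) path of G, given by its vertex sequence: at least one
  -- vertex, no repeated vertex, consecutive vertices joined by an edge.
  -- s(P) = head P, t(P) = last P.
  IsPath : List (Fin n) → Set
  IsPath P = (P ≢ []) × Unique P × Linked Edge P

  -- The subdigraph P₁ ∪ P₂ (of two paths) is the path Q:
  -- same vertex set and same edge set.
  UnionIs : List (Fin n) → List (List (Fin n)) → Set
  UnionIs Q Ps = ((v : Fin n) → v ∈ Q ⇔ Any (λ P → v ∈ P) Ps)
               × ((u w : Fin n) → Consec Q u w ⇔ Any (λ P → Consec P u w) Ps)

  InMinusLast : List (Fin n) → Fin n → Set
  InMinusLast P x = x ∈ P × (last P ≢ just x)

  InMinusFirst : List (Fin n) → Fin n → Set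
  InMinusFirst P x = x ∈ P × (head P ≢ just x)

  Inward : (Fin n → Set) → Fin n → Set
  Inward F v = ¬ F v × ((x : Fin n) → F x → ¬ Edge x v)

  Outward : (Fin n → Set) → Fin n → Set
  Outward F v = ¬ F v × ((x : Fin n) → F x → ¬ Edge v x)

  module _ {k : ℕ} (s t : Fin k → Fin n) where

    IsLinkage : Vec (List (Fin n)) k → Set
    IsLinkage L = ((j : Fin k) → IsPath (lookup L j))
                × ((i j : Fin k) → i ≢ j → (v : Fin n) →
                     v ∈ lookup L i → v ∈ lookup L j → ⊥)

    InV : Vec (List (Fin n)) k → Fin n → Set
    InV L v = Σ (Fin k) λ j → v ∈ lookup L j

    IsLinkageFor : Vec (List (Fin n)) k → Set
    IsLinkageFor P = IsLinkage P
                   × ((j : Fin k) → head (lookup P j) ≡ just (s j)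
                                  × last (lookup P j) ≡ just (t j))

    A : Vec (List (Fin n)) k → Fin n → Set
    A L v = ¬ InV L v × Σ (Fin k) λ j →
              (last (lookup L j) ≢ just (t j)) × Inward (InMinusLast (lookup L j)) v

    B : Vec (List (Fin n)) k → Fin n → Set
    B L v = ¬ InV L v × Σ (Fin k) λ j →
              (head (lookup L j) ≢ just (s j)) × Outward (InMinusFirst (lookup L j)) v

    -- |S| ≤ c for a set S of vertices: S has a duplicate-free
    -- enumeration of length at most c.
    CardAtMost : (Fin n → Set) → ℕ → Set
    CardAtMost S c = Σ (List (Fin n)) λ xs →
                       Unique xs × ((v : Fin n) → v ∈ xs ⇔ S v) × length xs ≤ c

    ConfusionAtMost : Vec (List (Fin n)) k → ℕ → Set
    ConfusionAtMost L c = CardAtMost (λ v → A L v × B L v) c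

    RawRail : Set
    RawRail = Vec (List (Fin n)) k × Subset n × Subset n

    IsRail : ℕ → ℕ → RawRail → Set
    IsRail m c (L , X , Y) =
        IsLinkage L
      × ((j : Fin k) → length (lookup L j) ≤ 2 * m
           × (length (lookup L j) < 2 * m →
                head (lookup L j) ≡ just (s j) ⊎ last (lookup L j) ≡ just (t j)))
      × ConfusionAtMost L c
      × ((v : Fin n) → v ∈ₛ X → ¬ InV L v)
      × ((v : Fin n) → v ∈ₛ Y → ¬ InV L v)
      × ((v : Fin n) → v ∈ₛ X → v ∈ₛ Y → ⊥)
      × ((v : Fin n) → v ∈ₛ X → A L v)
      × ((v : Fin n) → v ∈ₛ Y → B L v)
      × ((v : Fin n) → (v ∈ₛ X ⊎ v ∈ₛ Y) ⇔ (A L v ⊎ B L v))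

    Arrow : RawRail → RawRail → Set
    Arrow (L , X , Y) (L' , X' , Y') =
        ((L , X , Y) ≢ (L' , X' , Y'))
      × ((i : Fin k) →
           (Σ (List (Fin n)) λ Q → IsPath Q
              × head Q ≡ head (lookup L i) × last Q ≡ last (lookup L' i)
              × UnionIs Q (lookup L i ∷ lookup L' i ∷ []))
         × ((v : Fin n) → v ∈ lookup L' i → v ∈ lookup L i ⊎ v ∈ₛ X)
         × ((v : Fin n) → v ∈ lookup L i → v ∈ lookup L' i ⊎ v ∈ₛ Y'))
      × X' ⊆ X × Y ⊆ Y'

    data HV : Set where
      s₀ t₀ : HV
      rail  : RawRail → HV

    IsHVertex : ℕ → ℕ → HV → Set
    IsHVertex m c s₀       = ⊤
    IsHVertex m c t₀       = ⊤
    IsHVertex m c (rail r) = IsRail m c r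

    HEdge : HV → HV → Set
    HEdge (rail r) (rail r') = Arrow r r'
    HEdge s₀ (rail (L , X , Y)) = (j : Fin k) → head (lookup L j) ≡ just (s j)
    HEdge (rail (L , X , Y)) t₀ = (j : Fin k) → last (lookup L j) ≡ just (t j)
    HEdge _ _ = ⊥

    IsHPath : ℕ → ℕ → List HV → Set
    IsHPath m c ps = (ps ≢ []) × All (IsHVertex m c) ps × Unique ps × Linked HEdge ps

    -- The H-path s₀, (L₁,X₁,Y₁), …, (L_p,X_p,Y_p), t₀ traces P.
    Traces : List RawRail → Vec (List (Fin n)) k → Set
    Traces rs P = IsLinkageFor P
                × ((j : Fin k) → UnionIs (lookup P j)
                     (map (λ { (L , X , Y) → lookup L j }) rs))

module Submission where

-- Fix an index j and write Mₚ for the j-th path of the rail Rₚ.  We build,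
-- rail by rail, a duplicate-free walk Fₚ of G from s_j which ends where Mₚ
-- ends, whose vertex and edge sets are those of M₁ ∪ … ∪ Mₚ, and all of
-- whose vertices outside Mₚ lie in the set Yₚ of Rₚ (the record Tracing).
-- At the arrow Rₚ → Rₚ₊₁ the union Mₚ ∪ Mₚ₊₁ is a path Q starting where
-- Mₚ starts and containing all edges of Mₚ, hence Q = Mₚ ++ ext; then
-- Fₚ₊₁ = Fₚ ++ ext works: ext consists of new vertices of Mₚ₊₁, and the
-- old vertices of Fₚ lie in Mₚ ∪ Yₚ ⊆ Mₚ₊₁ ∪ Yₚ₊₁.  Since Yₚ₊₁ avoids the
-- linkage of Rₚ₊₁, this last fact also keeps the walks for different
-- indices disjoint.  At t₀ each walk ends at t_j, so the walks form the
-- traced linkage.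

open import Defs
open import Data.Nat using (ℕ)
open import Data.Bool using (Bool)
open import Data.Fin using (Fin)
open import Data.Fin.Subset using (Subset; _⊆_) renaming (_∈_ to _∈ₛ_)
open import Data.Vec using (Vec; lookup; tabulate)
open import Data.Vec.Properties using (lookup∘tabulate)
open import Data.List using (List; []; _∷_; _++_; [_]; map; head; last)
open import Data.List.Properties using (++-assoc; ++-identityʳ; map-++)
open import Data.List.Membership.Propositional using (_∈_; lose)
open import Data.List.Membership.Propositional.Properties using (∈-++⁺ˡ; ∈-++⁺ʳ; ∈-++⁻)
open import Data.List.Relation.Unary.Any using (Any; here; there)
import Data.List.Relation.Unary.Any.Properties as Any
open import Data.List.Relation.Unary.All using (All; _∷_)
open import Data.List.Relation.Unary.Linked using (Linked; []; [-]; _∷_)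
open import Data.List.Relation.Unary.Unique.Propositional using (Unique)
open import Data.List.Relation.Unary.Unique.Propositional.Properties using (++⁺; Unique[x∷xs]⇒x∉xs)
open import Data.List.Relation.Unary.AllPairs using (_∷_)
open import Data.Maybe using (just)
open import Data.Product using (Σ; _×_; _,_; proj₁; proj₂)
import Data.Product as Product
open import Data.Sum using (_⊎_; inj₁; inj₂)
open import Data.Empty using (⊥; ⊥-elim)
open import Relation.Nullary using (¬_)
open import Relation.Binary.PropositionalEquality using (_≡_; _≢_; refl; sym; trans; subst; cong)

module _ {n : ℕ} where

  consec⇒∈ : ∀ {xs : List (Fin n)} {u w} → Consec xs u w → u ∈ xs
  consec⇒∈ {x ∷ y ∷ _} (inj₁ (refl , _)) = here refl
  consec⇒∈ {x ∷ y ∷ _} (inj₂ c)          = there (consec⇒∈ c)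

  linked⇒consec : ∀ {R : Fin n → Fin n → Set} {xs u w} → Linked R xs → Consec xs u w → R u w
  linked⇒consec (r ∷ _)  (inj₁ (refl , refl)) = r
  linked⇒consec (_ ∷ rs) (inj₂ c)             = linked⇒consec rs c

  consec⇒linked : ∀ {R : Fin n → Fin n → Set} (xs : List (Fin n)) →
    (∀ {u w} → Consec xs u w → R u w) → Linked R xs
  consec⇒linked []          _ = []
  consec⇒linked (x ∷ [])    _ = [-]
  consec⇒linked (x ∷ y ∷ r) R-pairs =
    R-pairs (inj₁ (refl , refl)) ∷ consec⇒linked (y ∷ r) (λ c → R-pairs (inj₂ c))

  consec-++⁻ : ∀ (P : List (Fin n)) {B u w} → Consec (P ++ B) u w →
    Consec P u w ⊎ (last P ≡ just u × head B ≡ just w) ⊎ Consec B u w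
  consec-++⁻ []          c = inj₂ (inj₂ c)
  consec-++⁻ (x ∷ [])    {y ∷ B} (inj₁ (refl , refl)) = inj₂ (inj₁ (refl , refl))
  consec-++⁻ (x ∷ [])    {y ∷ B} (inj₂ c)             = inj₂ (inj₂ c)
  consec-++⁻ (x ∷ y ∷ P) (inj₁ e) = inj₁ (inj₁ e)
  consec-++⁻ (x ∷ y ∷ P) (inj₂ c) with consec-++⁻ (y ∷ P) c
  ... | inj₁ cP   = inj₁ (inj₂ cP)
  ... | inj₂ rest = inj₂ rest

  consec-++⁺ˡ : ∀ (P : List (Fin n)) {B u w} → Consec P u w → Consec (P ++ B) u w
  consec-++⁺ˡ (x ∷ y ∷ P) (inj₁ e) = inj₁ e
  consec-++⁺ˡ (x ∷ y ∷ P) (inj₂ c) = inj₂ (consec-++⁺ˡ (y ∷ P) c)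

  consec-++⁺ʳ : ∀ (P : List (Fin n)) {B u w} → Consec B u w → Consec (P ++ B) u w
  consec-++⁺ʳ []          c = c
  consec-++⁺ʳ (x ∷ [])    {y ∷ B} c = inj₂ c
  consec-++⁺ʳ (x ∷ y ∷ P) c = inj₂ (consec-++⁺ʳ (y ∷ P) c)

  consec-junction : ∀ (P : List (Fin n)) {B u w} →
    last P ≡ just u → head B ≡ just w → Consec (P ++ B) u w
  consec-junction (x ∷ [])    {y ∷ B} refl refl = inj₁ (refl , refl)
  consec-junction (x ∷ y ∷ P) l h = inj₂ (consec-junction (y ∷ P) l h)

  head-++ : ∀ (P : List (Fin n)) {B a} → head P ≡ just a → head (P ++ B) ≡ just a
  head-++ (x ∷ P) h = h

  last-++-∷ : ∀ (P : List (Fin n)) {y B} → last (P ++ y ∷ B) ≡ last (y ∷ B)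
  last-++-∷ []          = refl
  last-++-∷ (x ∷ [])    = refl
  last-++-∷ (x ∷ z ∷ P) = last-++-∷ (z ∷ P)

  last-++ : ∀ (P M B : List (Fin n)) → last P ≡ last M → last (P ++ B) ≡ last (M ++ B)
  last-++ P M []      e = trans (cong last (++-identityʳ P)) (trans e (sym (cong last (++-identityʳ M))))
  last-++ P M (y ∷ B) _ = trans (last-++-∷ P) (sym (last-++-∷ M))

  unique-++ʳ : ∀ (P : List (Fin n)) {B} → Unique (P ++ B) → Unique B
  unique-++ʳ []      u        = u
  unique-++ʳ (_ ∷ P) (_ ∷ uP) = unique-++ʳ P uP

  unique-++-disjoint : ∀ (P : List (Fin n)) {B v} → Unique (P ++ B) → v ∈ P → v ∈ B → ⊥
  unique-++-disjoint (x ∷ P) u        (here refl) vB = Unique[x∷xs]⇒x∉xs u (∈-++⁺ʳ P vB)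
  unique-++-disjoint (x ∷ P) (_ ∷ uP) (there vP)  vB = unique-++-disjoint P uP vP vB

  first-pair : ∀ {x z w : Fin n} {Q} → Unique (x ∷ z ∷ Q) → Consec (x ∷ z ∷ Q) x w → w ≡ z
  first-pair _ (inj₁ (_ , w≡z)) = w≡z
  first-pair u (inj₂ c)         = ⊥-elim (Unique[x∷xs]⇒x∉xs u (consec⇒∈ c))

  drop-first-pair : ∀ {x y u w : Fin n} {Q} → u ≢ x → Consec (x ∷ y ∷ Q) u w → Consec (y ∷ Q) u w
  drop-first-pair u≢x (inj₁ (u≡x , _)) = ⊥-elim (u≢x u≡x)
  drop-first-pair _   (inj₂ c)         = c

  extends : ∀ (M Q : List (Fin n)) → M ≢ [] → Unique M → Unique Q → head Q ≡ head M →
    (∀ {u w} → Consec M u w → Consec Q u w) → Σ (List (Fin n)) λ ext → Q ≡ M ++ ext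
  extends []          _            M≢[] _ _ _    _   = ⊥-elim (M≢[] refl)
  extends (x ∷ M)     []           _    _ _ ()   _
  extends (x ∷ [])    (.x ∷ Q)     _    _ _ refl _   = Q , refl
  extends (x ∷ y ∷ M) (.x ∷ [])    _    _ _ refl sub = ⊥-elim (sub (inj₁ (refl , refl)))
  extends (x ∷ y ∷ M) (.x ∷ z ∷ Q) _ uM@(_ ∷ uyM) uQ@(_ ∷ uzQ) refl sub
    with first-pair uQ (sub (inj₁ (refl , refl)))
  ... | refl = Product.map₂ (cong (x ∷_)) (extends (y ∷ M) (y ∷ Q) (λ ()) uyM uzQ refl later)
    where
    later : ∀ {u w} → Consec (y ∷ M) u w → Consec (y ∷ Q) u w
    later c = drop-first-pair (λ { refl → Unique[x∷xs]⇒x∉xs uM (consec⇒∈ c) }) (sub (inj₂ c))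

-- Composing unions, pointwise for any containment predicate Has (used for
-- vertices and for edges): if G = F ∪ Q, F = ⋃ Ms, Q = M ∪ M' and M is one
-- of the Ms, then G = ⋃ (Ms ++ [ M' ]).
union-compose : ∀ {A : Set} {Has : A → Set} {G F Q M M' : A} {Ms : List A} →
  (Has G ⇔ Any Has (F ∷ Q ∷ [])) → (Has F ⇔ Any Has Ms) →
  (Has Q ⇔ Any Has (M ∷ M' ∷ [])) → M ∈ Ms → Has G ⇔ Any Has (Ms ++ [ M' ])
union-compose {Has = Has} {G} {M' = M'} {Ms} (G⇒ , ⇒G) (F⇒ , ⇒F) (Q⇒ , ⇒Q) M∈Ms = to , from
  where
  to : Has G → Any Has (Ms ++ [ M' ])
  to h with G⇒ h
  ... | here hF = Any.++⁺ˡ (F⇒ hF)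
  ... | there (here hQ) with Q⇒ hQ
  ...   | here hM          = Any.++⁺ˡ (lose M∈Ms hM)
  ...   | there (here hM') = Any.++⁺ʳ Ms (here hM')
  from : Any Has (Ms ++ [ M' ]) → Has G
  from a with Any.++⁻ Ms a
  ... | inj₁ aMs         = ⇒G (here (⇒F aMs))
  ... | inj₂ (here hM') = ⇒G (there (here (⇒Q (there (here hM')))))

module _ {n : ℕ} (E : Fin n → Fin n → Bool) where

  glue : ∀ (F M ext : List (Fin n)) → last F ≡ last M →
    (∀ {v} → v ∈ M → v ∈ F) → (∀ {u w} → Consec M u w → Consec F u w) →
    UnionIs E (F ++ ext) (F ∷ (M ++ ext) ∷ [])
  glue F M ext ends M⊆F pairsM⊆F = (λ _ → vertex⇒ , ⇒vertex) , (λ _ _ → pair⇒ , ⇒pair)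
    where
    vertex⇒ : ∀ {v} → v ∈ F ++ ext → Any (v ∈_) (F ∷ (M ++ ext) ∷ [])
    vertex⇒ vG with ∈-++⁻ F vG
    ... | inj₁ vF = here vF
    ... | inj₂ ve = there (here (∈-++⁺ʳ M ve))
    ⇒vertex : ∀ {v} → Any (v ∈_) (F ∷ (M ++ ext) ∷ []) → v ∈ F ++ ext
    ⇒vertex (here vF) = ∈-++⁺ˡ vF
    ⇒vertex (there (here vQ)) with ∈-++⁻ M vQ
    ... | inj₁ vM = ∈-++⁺ˡ (M⊆F vM)
    ... | inj₂ ve = ∈-++⁺ʳ F ve
    pair⇒ : ∀ {u w} → Consec (F ++ ext) u w → Any (λ P → Consec P u w) (F ∷ (M ++ ext) ∷ [])
    pair⇒ c with consec-++⁻ F c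
    ... | inj₁ cF              = here cF
    ... | inj₂ (inj₁ (l , h)) = there (here (consec-junction M (trans (sym ends) l) h))
    ... | inj₂ (inj₂ ce)       = there (here (consec-++⁺ʳ M ce))
    ⇒pair : ∀ {u w} → Any (λ P → Consec P u w) (F ∷ (M ++ ext) ∷ []) → Consec (F ++ ext) u w
    ⇒pair (here cF) = consec-++⁺ˡ F cF
    ⇒pair (there (here cQ)) with consec-++⁻ M cQ
    ... | inj₁ cM              = consec-++⁺ˡ F (pairsM⊆F cM)
    ... | inj₂ (inj₁ (l , h)) = consec-junction F (trans ends l) h
    ... | inj₂ (inj₂ ce)       = consec-++⁺ʳ F ce

  record Tracing (a : Fin n) (Ms : List (List (Fin n))) (M : List (Fin n))
                 (Y : Subset n) (F : List (Fin n)) : Set where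
    field
      starts   : head F ≡ just a
      unique   : Unique F
      linked   : Linked (Edge E) F
      ends     : last F ≡ last M
      union    : UnionIs E F Ms
      current  : M ∈ Ms
      leftover : ∀ v → v ∈ F → v ∈ M ⊎ v ∈ₛ Y

    isPath : IsPath E F
    isPath = (λ { refl → nonempty starts }) , unique , linked
      where
      nonempty : head [] ≡ just a → ⊥
      nonempty ()

    covers-vertices : ∀ {v} → v ∈ M → v ∈ F
    covers-vertices vM = proj₂ (proj₁ union _) (lose current vM)

    covers-pairs : ∀ {u w} → Consec M u w → Consec F u w
    covers-pairs c = proj₂ (proj₂ union _ _) (lose current c)

  open Tracing

  tracing-start : ∀ {a M} {Y : Subset n} → IsPath E M → head M ≡ just a → Tracing a [ M ] M Y M
  tracing-start (_ , uM , lM) h = record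
    { starts   = h
    ; unique   = uM
    ; linked   = lM
    ; ends     = refl
    ; union    = (λ _ → here , λ { (here vM) → vM }) , (λ _ _ → here , λ { (here c) → c })
    ; current  = here refl
    ; leftover = λ _ → inj₁
    }

  Joins : List (Fin n) → List (Fin n) → Set
  Joins M M' = Σ (List (Fin n)) λ Q → IsPath E Q × head Q ≡ head M × last Q ≡ last M'
                                    × UnionIs E Q (M ∷ M' ∷ [])

  Continuation : List (Fin n) → List (Fin n) → List (Fin n) → Set
  Continuation M M' ext = IsPath E (M ++ ext) × last (M ++ ext) ≡ last M'
                        × UnionIs E (M ++ ext) (M ∷ M' ∷ [])

  joins⇒continuation : ∀ {M M'} → IsPath E M → Joins M M' → Σ (List (Fin n)) (Continuation M M')
  joins⇒continuation {M} (M≢[] , uM , _) (Q , pQ@(_ , uQ , _) , hQ , lQ , UQ)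
    with extends M Q M≢[] uM uQ hQ (λ c → proj₂ (proj₂ UQ _ _) (here c))
  ... | ext , refl = ext , pQ , lQ , UQ

  continuation⊆ : ∀ {M M' ext v} → Continuation M M' ext → v ∈ ext → v ∈ M'
  continuation⊆ {M} ((_ , uQ , _) , _ , vertices , _) ve with proj₁ (vertices _) (∈-++⁺ʳ M ve)
  ... | here vM          = ⊥-elim (unique-++-disjoint M uQ vM ve)
  ... | there (here vM') = vM'

  carried : ∀ {a Ms M M' Y Y' F} → Tracing a Ms M Y F →
    (∀ v → v ∈ M → v ∈ M' ⊎ v ∈ₛ Y') → Y ⊆ Y' → ∀ v → v ∈ F → v ∈ M' ⊎ v ∈ₛ Y'
  carried T M⊆ Y⊆ v vF with leftover T v vF
  ... | inj₁ vM = M⊆ v vM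
  ... | inj₂ vY = inj₂ (Y⊆ vY)

  extend : ∀ {a Ms M M' Y Y' F ext} → Tracing a Ms M Y F → Continuation M M' ext →
    (∀ v → v ∈ M → v ∈ M' ⊎ v ∈ₛ Y') → Y ⊆ Y' → (∀ v → v ∈ₛ Y' → v ∈ M' → ⊥) →
    Tracing a (Ms ++ [ M' ]) M' Y' (F ++ ext)
  extend {Ms = Ms} {M} {M'} {Y' = Y'} {F} {ext} T C@((_ , uQ , lQ) , endQ , UQ) M⊆ Y⊆ Y'#M' = record
    { starts   = head-++ F (starts T)
    ; unique   = ++⁺ (unique T) (unique-++ʳ M uQ) λ { {v} (vF , ve) → old-not-new v vF ve }
    ; linked   = consec⇒linked (F ++ ext) edge
    ; ends     = trans (last-++ F M ext (ends T)) endQ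
    ; union    = (λ v → union-compose (proj₁ G v) (proj₁ (union T) v) (proj₁ UQ v) (current T))
               , (λ u w → union-compose (proj₂ G u w) (proj₂ (union T) u w) (proj₂ UQ u w) (current T))
    ; current  = ∈-++⁺ʳ Ms (here refl)
    ; leftover = new-leftover
    }
    where
    G : UnionIs E (F ++ ext) (F ∷ (M ++ ext) ∷ [])
    G = glue F M ext (ends T) (covers-vertices T) (covers-pairs T)

    old-not-new : ∀ v → v ∈ F → v ∈ ext → ⊥
    old-not-new v vF ve with leftover T v vF
    ... | inj₁ vM = unique-++-disjoint M uQ vM ve
    ... | inj₂ vY = Y'#M' v (Y⊆ vY) (continuation⊆ C ve)

    edge : ∀ {u w} → Consec (F ++ ext) u w → Edge E u w
    edge c with proj₁ (proj₂ G _ _) c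
    ... | here cF          = linked⇒consec (linked T) cF
    ... | there (here cQ) = linked⇒consec lQ cQ

    new-leftover : ∀ v → v ∈ F ++ ext → v ∈ M' ⊎ v ∈ₛ Y'
    new-leftover v vG with ∈-++⁻ F vG
    ... | inj₁ vF = carried T M⊆ Y⊆ v vF
    ... | inj₂ ve = inj₁ (continuation⊆ C ve)

module _ {n k : ℕ} (E : Fin n → Fin n → Bool) (s t : Fin k → Fin n) (m c : ℕ) where

  Rail : Set
  Rail = RawRail E s t

  pathAt : Fin k → Rail → List (Fin n)
  pathAt j r = lookup (proj₁ r) j

  Yof : Rail → Subset n
  Yof r = proj₂ (proj₂ r)

  Traced : List Rail → Set
  Traced rs = Σ (Vec (List (Fin n)) k) (Traces E s t rs)

  Y-avoids-linkage : ∀ {r} → IsRail E s t m c r → ∀ v → v ∈ₛ Yof r → ¬ InV E s t (proj₁ r) v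
  Y-avoids-linkage (_ , _ , _ , _ , avoids , _) = avoids

  record Progress (done : List Rail) (cur : Rail) : Set where
    field
      trail    : Fin k → List (Fin n)
      tracing  : ∀ j → Tracing E (s j) (map (pathAt j) done) (pathAt j cur) (Yof cur) (trail j)
      disjoint : ∀ i j → i ≢ j → ∀ v → v ∈ trail i → v ∈ trail j → ⊥

  open Progress

  start : ∀ {r} → IsRail E s t m c r → HEdge E s t s₀ (rail r) → Progress [ r ] r
  start {r} ((paths , linkage-disjoint) , _) from-s = record
    { trail    = λ j → pathAt j r
    ; tracing  = λ j → tracing-start E (paths j) (from-s j)
    ; disjoint = linkage-disjoint
    }

  advance : ∀ {done cur nxt} → Progress done cur → IsRail E s t m c cur → IsRail E s t m c nxt →
    Arrow E s t cur nxt → Progress (done ++ [ nxt ]) nxt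
  advance {done} {cur} {nxt} P ((paths , _) , _) nxt-rail@((_ , nxt-disjoint) , _) (_ , per-index , _ , Y⊆Y') =
    record { trail = trail' ; tracing = tracing' ; disjoint = disjoint' }
    where
    continuation : ∀ j → Σ (List (Fin n)) (Continuation E (pathAt j cur) (pathAt j nxt))
    continuation j = joins⇒continuation E (paths j) (proj₁ (per-index j))

    trail' : Fin k → List (Fin n)
    trail' j = trail P j ++ proj₁ (continuation j)

    tracing' : ∀ j → Tracing E (s j) (map (pathAt j) (done ++ [ nxt ])) (pathAt j nxt) (Yof nxt) (trail' j)
    tracing' j = subst (λ Ms → Tracing E (s j) Ms (pathAt j nxt) (Yof nxt) (trail' j))
      (sym (map-++ (pathAt j) done [ nxt ]))
      (extend E (tracing P j) (proj₂ (continuation j)) (proj₂ (proj₂ (per-index j))) Y⊆Y'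
         (λ v vY vM' → Y-avoids-linkage {nxt} nxt-rail v vY (j , vM')))

    -- A vertex of the next rail's linkage on the j-th new trail lies on its
    -- j-th path, because the new trail lies in that path ∪ Y'.
    meets-next : ∀ i j v → v ∈ pathAt i nxt → v ∈ trail' j → v ∈ pathAt j nxt
    meets-next i j v vM'ᵢ vj with Tracing.leftover (tracing' j) v vj
    ... | inj₁ vM'ⱼ = vM'ⱼ
    ... | inj₂ vY   = ⊥-elim (Y-avoids-linkage {nxt} nxt-rail v vY (i , vM'ᵢ))

    new⊆next : ∀ j v → v ∈ proj₁ (continuation j) → v ∈ pathAt j nxt
    new⊆next j v = continuation⊆ E (proj₂ (continuation j))

    disjoint' : ∀ i j → i ≢ j → ∀ v → v ∈ trail' i → v ∈ trail' j → ⊥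
    disjoint' i j i≢j v vi vj with ∈-++⁻ (trail P i) vi | ∈-++⁻ (trail P j) vj
    ... | inj₁ old-i | inj₁ old-j = disjoint P i j i≢j v old-i old-j
    ... | inj₂ new-i | _          =
      nxt-disjoint i j i≢j v (new⊆next i v new-i) (meets-next i j v (new⊆next i v new-i) vj)
    ... | inj₁ _     | inj₂ new-j =
      nxt-disjoint i j i≢j v (meets-next j i v (new⊆next j v new-j) vi) (new⊆next j v new-j)

  at-tabulate : ∀ {A : Set} (B : Fin k → A → Set) (f : Fin k → A) →
    (∀ j → B j (f j)) → ∀ j → B j (lookup (tabulate f) j)
  at-tabulate B f Bf j = subst (B j) (sym (lookup∘tabulate f j)) (Bf j)

  finish : ∀ {done cur} → Progress done cur → HEdge E s t (rail cur) t₀ → Traced done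
  finish {done} P to-t =
    tabulate (trail P) , (((λ j → proj₁ (traced j)) , disjoint-paths) , (λ j → proj₁ (proj₂ (traced j))))
                       , (λ j → proj₂ (proj₂ (traced j)))
    where
    Traced-path : Fin k → List (Fin n) → Set
    Traced-path j F = IsPath E F × (head F ≡ just (s j) × last F ≡ just (t j))
                    × UnionIs E F (map (pathAt j) done)

    traced : ∀ j → Traced-path j (lookup (tabulate (trail P)) j)
    traced = at-tabulate Traced-path (trail P) λ j → let T = tracing P j in
      Tracing.isPath T , (Tracing.starts T , trans (Tracing.ends T) (to-t j)) , Tracing.union T

    disjoint-paths : ∀ i j → i ≢ j → ∀ v → v ∈ lookup (tabulate (trail P)) i →
      v ∈ lookup (tabulate (trail P)) j → ⊥
    disjoint-paths i j i≢j v vi vj = disjoint P i j i≢j v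
      (subst (v ∈_) (lookup∘tabulate (trail P) i) vi) (subst (v ∈_) (lookup∘tabulate (trail P) j) vj)

  trace-from : ∀ done cur rest → Progress done cur → IsRail E s t m c cur →
    All (IsHVertex E s t m c) (map rail rest ++ [ t₀ ]) →
    Linked (HEdge E s t) (rail cur ∷ map rail rest ++ [ t₀ ]) → Traced (done ++ rest)
  trace-from done cur [] P _ _ (to-t ∷ [-]) =
    subst Traced (sym (++-identityʳ done)) (finish P to-t)
  trace-from done cur (r ∷ rest) P cur-rail (r-rail ∷ rails) (arrow ∷ edges) =
    subst Traced (++-assoc done [ r ] rest)
      (trace-from (done ++ [ r ]) r rest (advance P cur-rail r-rail arrow) r-rail rails edges)

mainTheorem8 : (k m c n : ℕ) (E : Fin n → Fin n → Bool) → Loopless E →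
    (s t : Fin k → Fin n) → (rs : List (RawRail E s t)) →
    IsHPath E s t m c (s₀ ∷ (map rail rs ++ [ t₀ ])) →
    Σ (Vec (List (Fin n)) k) (λ P → Traces E s t rs P)
mainTheorem8 k m c n E _ s t [] (_ , _ , _ , (() ∷ _))
mainTheorem8 k m c n E _ s t (r ∷ rs) (_ , (_ ∷ r-rail ∷ rails) , _ , (from-s ∷ edges)) =
  trace-from E s t m c [ r ] r rs (start E s t m c r-rail from-s) r-rail rails edges
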